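{- The (non-homogeneous) quasimodular forms $$J_{1} = \frac{5}{36} E_{2}^{2} + \frac{1}{9} E_{4} - \frac{1}{4} E_{2},\qquad J_{2} = E_{2} - E_{6}$$ are completely positive, i.e. all coefficients of their $q$-expansions are nonnegative.
   Context: $q=e^{2\pi i z}$, $E_2 = 1 - 24\sum_{n\ge1}\sigma_1(n)q^n$, $E_4 = 1+240\sum_{n\ge1}\sigma_3(n)q^n$, $E_6 = 1-504\sum_{n\ge1}\sigma_5(n)q^n$, where $\sigma_a(n)=\sum_{d\mid n}d^a$. -}

module Defs where

open import Data.Nat as ℕ using (ℕ; zero; suc; _^_)
open import Data.Nat.Divisibility using (_∣?_)
open import Data.List using (List; filter; map; foldr; upTo; applyUpTo)
open import Data.Nat.ListAction using (sum)
open import Data.Integer as ℤ using (ℤ; +_; -[1+_])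
open import Data.Rational as ℚ using (ℚ; _+_; _*_; -_; _-_; _/_; 0ℚ; 1ℚ)

-- Formal q-series with rational coefficients: the n-th coefficient of q^n.
QSeries : Set
QSeries = ℕ → ℚ

sumℚ : List ℚ → ℚ
sumℚ = foldr _+_ 0ℚ

-- σ_a(n) = Σ_{d ∣ n} d^a  (divisors d ∈ {1,…,n}); σ_a(0) = 0 (unused)
σ : ℕ → ℕ → ℕ
σ a n = sum (map (λ d → d ^ a) (filter (λ d → d ∣? n) (applyUpTo suc n)))

ℕ→ℚ : ℕ → ℚ
ℕ→ℚ n = (+ n) / 1

E₂ : QSeries
E₂ zero    = 1ℚ
E₂ (suc n) = - ((+ 24 / 1) * ℕ→ℚ (σ 1 (suc n)))

E₄ : QSeries
E₄ zero    = 1ℚ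
E₄ (suc n) = (+ 240 / 1) * ℕ→ℚ (σ 3 (suc n))

E₆ : QSeries
E₆ zero    = 1ℚ
E₆ (suc n) = - ((+ 504 / 1) * ℕ→ℚ (σ 5 (suc n)))

_⊕_ : QSeries → QSeries → QSeries
(f ⊕ g) n = f n + g n

_⊖_ : QSeries → QSeries → QSeries
(f ⊖ g) n = f n - g n

_·_ : ℚ → QSeries → QSeries
(c · f) n = c * f n

_⊛_ : QSeries → QSeries → QSeries
(f ⊛ g) n = sumℚ (map (λ k → f k * g (n ℕ.∸ k)) (upTo (suc n)))

infixl 6 _⊕_ _⊖_
infixl 7 _·_ _⊛_

J₁ : QSeries
J₁ = (+ 5 / 36) · (E₂ ⊛ E₂) ⊕ (+ 1 / 9) · E₄ ⊖ (+ 1 / 4) · E₂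

J₂ : QSeries
J₂ = E₂ ⊖ E₆

CompletelyPositive : QSeries → Set
CompletelyPositive f = ∀ n → 0ℚ ℚ.≤ f n

-- For n ≥ 1 every inner term E₂(k) E₂(n−k), 0 < k < n, of the Cauchy square is a product of
-- two nonpositive coefficients, so (E₂²)ₙ ≥ 2 E₂(n) = −48 σ₁(n). Hence
-- J₁(n) ≥ (80/3) σ₃(n) − (2/3) σ₁(n) ≥ 0, and J₂(n) = 504 σ₅(n) − 24 σ₁(n) ≥ 0, both because
-- σ₁(n) ≤ σₖ(n) for k ≥ 1. The constant terms of J₁ and J₂ vanish.
module Submission where

open import Defs
open import Data.Product using (_×_; _,_)
open import Data.Nat as ℕ using (ℕ; zero; suc; _^_; _∸_; z≤n; s≤s)
import Data.Nat.Properties as ℕ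
open import Data.Nat.Coprimality using (1-coprimeTo) renaming (sym to coprime-sym)
open import Data.Nat.Divisibility using (_∣?_)
open import Data.Nat.ListAction using (sum)
open import Data.Integer as ℤ using (+_)
import Data.Integer.Properties as ℤ
open import Data.Rational as ℚ using (ℚ; mkℚ; _+_; _*_; -_; _-_; _/_; 0ℚ; _≤_; *≤*)
import Data.Rational.Properties as ℚ
open import Data.Rational.Solver using (module +-*-Solver)
open import Data.List using (List; []; _∷_; _∷ʳ_; map; filter; applyUpTo)
import Data.List.Properties as List
open import Data.List.Relation.Unary.All using (All; []; _∷_)
open import Data.List.Relation.Unary.All.Properties using (applyUpTo⁺₁)
open import Relation.Binary.PropositionalEquality
  using (_≡_; refl; sym; trans; cong; cong₂; subst; subst₂; module ≡-Reasoning)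

^-monoʳ-≤-suc : ∀ d {a b} → a ℕ.≤ b → d ^ suc a ℕ.≤ d ^ suc b
^-monoʳ-≤-suc zero    _   = z≤n
^-monoʳ-≤-suc (suc d) a≤b = ℕ.^-monoʳ-≤ (suc d) (s≤s a≤b)

sum-map-mono-≤ : ∀ {f g : ℕ → ℕ} → (∀ x → f x ℕ.≤ g x) → ∀ xs → sum (map f xs) ℕ.≤ sum (map g xs)
sum-map-mono-≤ f≤g []       = z≤n
sum-map-mono-≤ f≤g (x ∷ xs) = ℕ.+-mono-≤ (f≤g x) (sum-map-mono-≤ f≤g xs)

σ-monoˡ-≤ : ∀ {a b} n → a ℕ.≤ b → σ (suc a) n ℕ.≤ σ (suc b) n
σ-monoˡ-≤ n a≤b = sum-map-mono-≤ (λ d → ^-monoʳ-≤-suc d a≤b) (filter (_∣? n) (applyUpTo suc n))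

ℕ→ℚ≡mkℚ : ∀ n → ℕ→ℚ n ≡ mkℚ (+ n) 0 (coprime-sym (1-coprimeTo n))
ℕ→ℚ≡mkℚ n = ℚ.normalize-coprime (coprime-sym (1-coprimeTo n))

ℕ→ℚ-mono-≤ : ∀ {m n} → m ℕ.≤ n → ℕ→ℚ m ≤ ℕ→ℚ n
ℕ→ℚ-mono-≤ {m} {n} m≤n rewrite ℕ→ℚ≡mkℚ m | ℕ→ℚ≡mkℚ n =
  *≤* (subst₂ ℤ._≤_ (sym (ℤ.*-identityʳ (+ m))) (sym (ℤ.*-identityʳ (+ n))) (ℤ.+≤+ m≤n))

ℕ→ℚ-nonNeg : ∀ n → 0ℚ ≤ ℕ→ℚ n
ℕ→ℚ-nonNeg n = ℕ→ℚ-mono-≤ {0} {n} z≤n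

/-nonNeg : ∀ n d .{{_ : ℕ.NonZero d}} → 0ℚ ≤ + n / d
/-nonNeg n d = ℚ.nonNegative⁻¹ _ {{ℚ.normalize-nonNeg n d}}

+-nonNeg : ∀ {p q} → 0ℚ ≤ p → 0ℚ ≤ q → 0ℚ ≤ p + q
+-nonNeg = ℚ.+-mono-≤

*-nonNeg : ∀ {p q} → 0ℚ ≤ p → 0ℚ ≤ q → 0ℚ ≤ p * q
*-nonNeg {p} {q} 0≤p 0≤q =
  ℚ.nonNegative⁻¹ _ {{ℚ.nonNeg*nonNeg⇒nonNeg p {{ℚ.nonNegative 0≤p}} q {{ℚ.nonNegative 0≤q}}}}

*-nonPos : ∀ {p q} → p ≤ 0ℚ → q ≤ 0ℚ → 0ℚ ≤ p * q
*-nonPos {p} {q} p≤0 q≤0 =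
  ℚ.nonNegative⁻¹ _ {{ℚ.nonPos*nonPos⇒nonPos p {{ℚ.nonPositive p≤0}} q {{ℚ.nonPositive q≤0}}}}

p≤q⇒0≤q-p : ∀ {p q} → p ≤ q → 0ℚ ≤ q - p
p≤q⇒0≤q-p {p} {q} p≤q = subst (_≤ q - p) (ℚ.+-inverseʳ p) (ℚ.+-monoˡ-≤ (- p) p≤q)

sumℚ-nonNeg : ∀ {xs} → All (0ℚ ≤_) xs → 0ℚ ≤ sumℚ xs
sumℚ-nonNeg []         = ℚ.≤-refl
sumℚ-nonNeg (px ∷ pxs) = +-nonNeg px (sumℚ-nonNeg pxs)

sumℚ-∷ʳ : ∀ xs x → sumℚ (xs ∷ʳ x) ≡ sumℚ xs + x
sumℚ-∷ʳ []       x = trans (ℚ.+-identityʳ x) (sym (ℚ.+-identityˡ x))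
sumℚ-∷ʳ (y ∷ xs) x = trans (cong (λ s → y + s) (sumℚ-∷ʳ xs x)) (sym (ℚ.+-assoc y (sumℚ xs) x))

⊛-suc : ∀ f g n → (f ⊛ g) (suc n) ≡
  f 0 * g (suc n) + (sumℚ (applyUpTo (λ k → f (suc k) * g (n ∸ k)) n) + f (suc n) * g 0)
⊛-suc f g n = cong (λ s → f 0 * g (suc n) + s) (begin
  sumℚ (map term (applyUpTo suc (suc n)))   ≡⟨ cong sumℚ (List.map-applyUpTo suc term (suc n)) ⟩
  sumℚ (applyUpTo (λ k → term (suc k)) (suc n))
    ≡⟨ cong sumℚ (sym (List.applyUpTo-∷ʳ (λ k → term (suc k)) n)) ⟩
  sumℚ (inner ∷ʳ term (suc n))             ≡⟨ sumℚ-∷ʳ inner (term (suc n)) ⟩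
  sumℚ inner + f (suc n) * g (n ∸ n)       ≡⟨ cong (λ m → sumℚ inner + f (suc n) * g m) (ℕ.n∸n≡0 n) ⟩
  sumℚ inner + f (suc n) * g 0             ∎)
  where
  open ≡-Reasoning
  term : ℕ → ℚ
  term k = f k * g (suc n ∸ k)
  inner : List ℚ
  inner = applyUpTo (λ k → term (suc k)) n

⊛-boundary-≤ : ∀ f g n → (∀ {k} → k ℕ.< n → 0ℚ ≤ f (suc k) * g (n ∸ k)) →
  f 0 * g (suc n) + f (suc n) * g 0 ≤ (f ⊛ g) (suc n)
⊛-boundary-≤ f g n inner-nonNeg = begin
  f 0 * g (suc n) + f (suc n) * g 0
    ≡⟨ cong (λ s → f 0 * g (suc n) + s) (sym (ℚ.+-identityˡ (f (suc n) * g 0))) ⟩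
  f 0 * g (suc n) + (0ℚ + f (suc n) * g 0)
    ≤⟨ ℚ.+-monoʳ-≤ (f 0 * g (suc n)) (ℚ.+-monoˡ-≤ (f (suc n) * g 0)
         (sumℚ-nonNeg (applyUpTo⁺₁ _ n inner-nonNeg))) ⟩
  f 0 * g (suc n) + (sumℚ (applyUpTo (λ k → f (suc k) * g (n ∸ k)) n) + f (suc n) * g 0)
    ≡⟨ sym (⊛-suc f g n) ⟩
  (f ⊛ g) (suc n) ∎
  where open ℚ.≤-Reasoning

E₂-nonPos : ∀ {n} → 0 ℕ.< n → E₂ n ≤ 0ℚ
E₂-nonPos {suc n} _ = ℚ.neg-antimono-≤ (*-nonNeg (/-nonNeg 24 1) (ℕ→ℚ-nonNeg (σ 1 (suc n))))

E₂²-lowerBound : ∀ n → E₂ (suc n) + E₂ (suc n) ≤ (E₂ ⊛ E₂) (suc n)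
E₂²-lowerBound n = subst (_≤ (E₂ ⊛ E₂) (suc n))
  (cong₂ _+_ (ℚ.*-identityˡ (E₂ (suc n))) (ℚ.*-identityʳ (E₂ (suc n))))
  (⊛-boundary-≤ E₂ E₂ n (λ {k} k<n →
    *-nonPos (E₂-nonPos {suc k} (s≤s z≤n)) (E₂-nonPos {n ∸ k} (ℕ.m<n⇒0<n∸m k<n))))

open +-*-Solver

-- The left-hand sides below are J₁ (suc n) and J₂ (suc n) unfolded, with E₂ (suc n) = −24 a.

J₁-suc : ∀ n → let a = ℕ→ℚ (σ 1 (suc n)); b = ℕ→ℚ (σ 3 (suc n)); C = (E₂ ⊛ E₂) (suc n) in
  J₁ (suc n) ≡ (+ 5 / 36) * (C - (E₂ (suc n) + E₂ (suc n))) + (+ 80 / 3) * (b - a) + (+ 26 / 1) * a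
J₁-suc n = solve 3 (λ C a b → let e = :- (con (+ 24 / 1) :* a) in
    con (+ 5 / 36) :* C :+ con (+ 1 / 9) :* (con (+ 240 / 1) :* b) :- con (+ 1 / 4) :* e
    := con (+ 5 / 36) :* (C :- (e :+ e)) :+ con (+ 80 / 3) :* (b :- a) :+ con (+ 26 / 1) :* a)
  refl ((E₂ ⊛ E₂) (suc n)) (ℕ→ℚ (σ 1 (suc n))) (ℕ→ℚ (σ 3 (suc n)))

J₂-suc : ∀ n → let a = ℕ→ℚ (σ 1 (suc n)); c = ℕ→ℚ (σ 5 (suc n)) in
  J₂ (suc n) ≡ (+ 24 / 1) * (c - a) + (+ 480 / 1) * c
J₂-suc n = solve 2 (λ a c →
    :- (con (+ 24 / 1) :* a) :- (:- (con (+ 504 / 1) :* c))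
    := con (+ 24 / 1) :* (c :- a) :+ con (+ 480 / 1) :* c)
  refl (ℕ→ℚ (σ 1 (suc n))) (ℕ→ℚ (σ 5 (suc n)))

lemma6p9 : CompletelyPositive J₁ × CompletelyPositive J₂
lemma6p9 = J₁-nonNeg , J₂-nonNeg
  where
  J₁-nonNeg : CompletelyPositive J₁
  J₁-nonNeg zero    = ℚ.≤-refl
  J₁-nonNeg (suc n) = subst (0ℚ ≤_) (sym (J₁-suc n))
    (+-nonNeg (+-nonNeg (*-nonNeg (/-nonNeg 5 36) (p≤q⇒0≤q-p (E₂²-lowerBound n)))
                        (*-nonNeg (/-nonNeg 80 3) (p≤q⇒0≤q-p σ₁≤σ₃)))
              (*-nonNeg (/-nonNeg 26 1) (ℕ→ℚ-nonNeg (σ 1 (suc n)))))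
    where
    σ₁≤σ₃ : ℕ→ℚ (σ 1 (suc n)) ≤ ℕ→ℚ (σ 3 (suc n))
    σ₁≤σ₃ = ℕ→ℚ-mono-≤ (σ-monoˡ-≤ {0} {2} (suc n) z≤n)

  J₂-nonNeg : CompletelyPositive J₂
  J₂-nonNeg zero    = ℚ.≤-refl
  J₂-nonNeg (suc n) = subst (0ℚ ≤_) (sym (J₂-suc n))
    (+-nonNeg (*-nonNeg (/-nonNeg 24 1) (p≤q⇒0≤q-p σ₁≤σ₅))
              (*-nonNeg (/-nonNeg 480 1) (ℕ→ℚ-nonNeg (σ 5 (suc n)))))
    where
    σ₁≤σ₅ : ℕ→ℚ (σ 1 (suc n)) ≤ ℕ→ℚ (σ 5 (suc n))
    σ₁≤σ₅ = ℕ→ℚ-mono-≤ (σ-monoˡ-≤ {0} {4} (suc n) z≤n)
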